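{- Let $G=(V,E)$ be a graph with node weights $c\colon V\to\mathbb{R}_{\ge0}$, root $r\in V$ and positive integer $k$, let $\mathrm{OPT}$ be the optimum value of the rooted node-weighted $k$-MST problem on this instance, and let $T$ be an optimum solution (a tree in $G$ containing $r$ and spanning at least $k$ vertices, of total node weight $\mathrm{OPT}$). Let $\varepsilon>0$. Then there exists a set $W\subseteq V(T)$ with $|W|\le 1/\varepsilon$ such that every node of $T$ is $\varepsilon$-distant to $W\cup\{r\}$.
   Context: For a node set $U\subseteq V$, a node $v$ is called $\varepsilon$-distant to $U$ if there exists a path $P$ in $G$ from $v$ to some node $u\in U$ with $c(V(P)\setminus\{u\})\le \varepsilon\cdot\mathrm{OPT}$, where $c(X)=\sum_{x\in X}c(x)$. (A path may be trivial, so every node of $U$ is $\varepsilon$-distant to $U$.)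
   Formalization: The node weights $c$ take values in the nonnegative rationals rather than $\mathbb{R}_{\ge0}$, and the parameter ε is a positive rational. -}

module Defs where

open import Data.Nat as ℕ using (ℕ; suc)
open import Data.Fin using (Fin)
open import Data.Fin.Subset using (Subset; _∈_; _⊆_; _∪_; ⁅_⁆; ∣_∣)
open import Data.List using (List; []; _∷_; length)
open import Data.List.Relation.Unary.Unique.Propositional using (Unique)
open import Data.Rational using (ℚ; 0ℚ; _+_; _*_; _≤_)
open import Data.Vec using (lookup)
open import Data.Vec.Functional using (foldr)
open import Data.Bool using (if_then_else_)
open import Data.Product using (Σ; _×_; ∃; ∃-syntax)
open import Relation.Nullary using (¬_)

Rel' : ℕ → Set₁
Rel' n = Fin n → Fin n → Set

record IsSimpleGraph {n : ℕ} (Adj : Rel' n) : Set where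
  field
    sym   : ∀ {u v} → Adj u v → Adj v u
    irref : ∀ {u} → ¬ Adj u u

data Walk {n : ℕ} (A : Rel' n) : Fin n → Fin n → Set where
  here : ∀ {v} → Walk A v v
  step : ∀ {u w v} → A u w → Walk A w v → Walk A u v

vertices : ∀ {n} {A : Rel' n} {u v} → Walk A u v → List (Fin n)
vertices {u = u} here = u ∷ []
vertices {u = u} (step _ w) = u ∷ vertices w

IsPath : ∀ {n} {A : Rel' n} {u v} → Walk A u v → Set
IsPath w = Unique (vertices w)

-- Cost of all vertices of the walk except its final vertex: for a path P
-- ending in u this is c(V(P) ∖ {u}).
costExceptEnd : ∀ {n} {A : Rel' n} {u v} → (Fin n → ℚ) → Walk A u v → ℚ
costExceptEnd c here = 0ℚ
costExceptEnd {u = u} c (step _ w) = c u + costExceptEnd c w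

weight : ∀ {n} → (Fin n → ℚ) → Subset n → ℚ
weight c X = foldr _+_ 0ℚ (λ i → if lookup X i then c i else 0ℚ)

record IsSubgraph {n : ℕ} (Adj : Rel' n) (VT : Subset n) (ET : Rel' n) : Set where
  field
    edge-sub : ∀ {u v} → ET u v → Adj u v
    edge-sym : ∀ {u v} → ET u v → ET v u
    edge-inˡ : ∀ {u v} → ET u v → u ∈ VT
    edge-inʳ : ∀ {u v} → ET u v → v ∈ VT

HasCycle : ∀ {n} → Rel' n → Set
HasCycle {n} ET = Σ (Fin n) λ u → Σ (Fin n) λ v → Σ (Walk ET u v) λ P →
  IsPath P × (3 ℕ.≤ length (vertices P)) × ET v u

record IsTree {n : ℕ} (Adj : Rel' n) (VT : Subset n) (ET : Rel' n) : Set where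
  field
    subgraph  : IsSubgraph Adj VT ET
    connected : ∀ {u v} → u ∈ VT → v ∈ VT → Walk ET u v
    acyclic   : ¬ HasCycle ET

record Feasible {n : ℕ} (Adj : Rel' n) (r : Fin n) (k : ℕ)
                (VT : Subset n) (ET : Rel' n) : Set where
  field
    tree  : IsTree Adj VT ET
    root  : r ∈ VT
    size  : k ℕ.≤ ∣ VT ∣

-- (VT, ET) is an optimum solution: feasible, and of minimum node weight
-- among all feasible solutions. Then OPT = weight c VT.
record Optimal {n : ℕ} (Adj : Rel' n) (c : Fin n → ℚ) (r : Fin n) (k : ℕ)
               (VT : Subset n) (ET : Rel' n) : Set₁ where
  field
    feasible : Feasible Adj r k VT ET
    minimal  : ∀ (VT' : Subset n) (ET' : Rel' n) →
               Feasible Adj r k VT' ET' → weight c VT ≤ weight c VT'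

-- v is ε-distant to U (w.r.t. threshold bound = ε·OPT): there is a path P in G
-- from v to some u ∈ U with c(V(P) ∖ {u}) ≤ bound.
Distant : ∀ {n} → Rel' n → (Fin n → ℚ) → ℚ → Subset n → Fin n → Set
Distant {n} Adj c bound U v =
  Σ (Fin n) λ u → u ∈ U × Σ (Walk Adj v u) λ P → IsPath P × (costExceptEnd c P ≤ bound)

{-# OPTIONS --safe #-}
-- List the vertices of T so that each precedes its parent in a tree rooted
-- at r, and sweep the list, carrying for every vertex a the largest cost h a
-- of a walk from an already swept descendant up to a. If h a + c a exceeds
-- εOPT, a becomes a centre; otherwise the walks are extended to a's parent b
-- by raising h b. The potential Σ (h + c) over the unswept vertices is at
-- most OPT initially, never increases, and drops by more than εOPT at every
-- centre, so there are at most 1/ε centres. Loop erasure turns the walks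
-- into paths.
module Submission where

open import Defs
open import Data.Nat using (ℕ; _≤_)
open import Data.Fin using (Fin)
open import Data.Fin.Subset using (Subset; _∈_; _⊆_; _∪_; ⁅_⁆; ∣_∣)
open import Data.Integer using (+_)
open import Data.Rational using (ℚ; 0ℚ; 1ℚ; _/_; _*_; _<_) renaming (_≤_ to _≤ℚ_)
open import Data.Product using (Σ; _×_)

open import Algebra.Bundles using (CommutativeMonoid)
open import Data.Bool using (true; false; if_then_else_)
open import Data.Empty using (⊥-elim)
open import Data.Fin using (zero; suc)
open import Data.Fin.Properties using (_≟_)
open import Data.Fin.Subset using (⊥)
open import Data.Fin.Subset.Properties as Subset using (_∈?_)
import Data.Integer as ℤ
import Data.Integer.Properties as ℤ
open import Data.List using (List; []; _∷_; filter; allFin)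
open import Data.List.Membership.Propositional using (_∉_) renaming (_∈_ to _∈ᴸ_)
open import Data.List.Membership.Propositional.Properties using (∈-allFin; ∈-filter⁺; ∈-filter⁻)
open import Data.List.Relation.Unary.All as All using ([]; _∷_)
open import Data.List.Relation.Unary.All.Properties using (¬Any⇒All¬)
open import Data.List.Relation.Unary.AllPairs using ([]; _∷_)
open import Data.List.Relation.Unary.Any using (here; there)
open import Data.List.Relation.Unary.Unique.Propositional using (Unique)
import Data.Nat as ℕ
import Data.Nat.Properties as ℕ
open import Data.Nat.Coprimality using (1-coprimeTo) renaming (sym to coprime-sym)
open import Data.Product using (_,_; proj₂)
open import Data.Rational using (mkℚ; _+_; _⊔_; _<?_; *≤*; positive; nonNegative)
open import Data.Rational.Properties hiding (_≟_)
open import Data.Sum as Sum using (_⊎_; inj₁; inj₂)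
open import Data.Vec using (lookup; _∷_; [])
open import Data.Vec.Functional using (updateAt)
open import Data.Vec.Functional.Properties using (updateAt-updates; updateAt-minimal)
open import Data.Vec.Properties using ([]=⇒lookup)
open import Function using (_∘_; const)
open import Relation.Binary.PropositionalEquality
  using (_≡_; _≢_; refl; sym; trans; cong; subst; subst₂; module ≡-Reasoning)
open import Relation.Nullary using (yes; no)

open import Algebra.Properties.Monoid.Sum +-0-monoid using (sum)
open import Algebra.Properties.CommutativeSemigroup
  (CommutativeMonoid.commutativeSemigroup +-0-commutativeMonoid)
  using (x∙yz≈y∙xz; xy∙z≈xz∙y)

p≤p+q : ∀ p {q} → 0ℚ ≤ℚ q → p ≤ℚ p + q
p≤p+q p {q} 0≤q = ≤-trans (≤-reflexive (sym (+-identityʳ p))) (+-monoʳ-≤ p 0≤q)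

p≤q+p : ∀ p {q} → 0ℚ ≤ℚ q → p ≤ℚ q + p
p≤q+p p {q} 0≤q = subst (p ≤ℚ_) (+-comm p q) (p≤p+q p 0≤q)

p⊔q≤p+q : ∀ {p q} → 0ℚ ≤ℚ p → 0ℚ ≤ℚ q → p ⊔ q ≤ℚ p + q
p⊔q≤p+q {p} {q} 0≤p 0≤q = ⊔-lub (p≤p+q p 0≤q) (p≤q+p q 0≤p)

+m/1≡mkℚ : ∀ m → + m / 1 ≡ mkℚ (+ m) 0 (coprime-sym (1-coprimeTo m))
+m/1≡mkℚ m = normalize-coprime (coprime-sym (1-coprimeTo m))

+suc/1 : ∀ m → + ℕ.suc m / 1 ≡ 1ℚ + + m / 1
+suc/1 m rewrite +m/1≡mkℚ m = cong (λ i → (+ 1 ℤ.+ i) / 1) (sym (ℤ.*-identityʳ (+ m)))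

/1-mono-≤ : ∀ {m k} → m ≤ k → + m / 1 ≤ℚ + k / 1
/1-mono-≤ {m} {k} m≤k rewrite +m/1≡mkℚ m | +m/1≡mkℚ k =
  *≤* (subst₂ ℤ._≤_ (sym (ℤ.*-identityʳ (+ m))) (sym (ℤ.*-identityʳ (+ k))) (ℤ.+≤+ m≤k))

sumOver : ∀ {A : Set} → (A → ℚ) → List A → ℚ
sumOver f []       = 0ℚ
sumOver f (x ∷ xs) = f x + sumOver f xs

module _ {A : Set} where

  sumOver-nonNeg : ∀ {f : A → ℚ} → (∀ x → 0ℚ ≤ℚ f x) → ∀ xs → 0ℚ ≤ℚ sumOver f xs
  sumOver-nonNeg 0≤f []       = ≤-refl
  sumOver-nonNeg 0≤f (x ∷ xs) = +-mono-≤ (0≤f x) (sumOver-nonNeg 0≤f xs)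

  sumOver-mono : ∀ {f g : A → ℚ} xs → (∀ {x} → x ∈ᴸ xs → f x ≤ℚ g x) →
                 sumOver f xs ≤ℚ sumOver g xs
  sumOver-mono []       f≤g = ≤-refl
  sumOver-mono (x ∷ xs) f≤g = +-mono-≤ (f≤g (here refl)) (sumOver-mono xs (f≤g ∘ there))

module _ {n : ℕ} where

  sumOver-pointUpdate : ∀ (b : Fin n) {f f' : Fin n → ℚ} {δ} {xs} → Unique xs → 0ℚ ≤ℚ δ →
                        (∀ y → y ≢ b → f' y ≤ℚ f y) → f' b ≤ℚ f b + δ →
                        sumOver f' xs ≤ℚ sumOver f xs + δ
  sumOver-pointUpdate b {δ = δ} {[]} _ 0≤δ _ _ = p≤p+q 0ℚ 0≤δ
  sumOver-pointUpdate b {f} {f'} {δ} {x ∷ xs} (x∉xs ∷ uniq) 0≤δ off at with x ≟ b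
  ... | yes refl = begin
    f' x + sumOver f' xs     ≤⟨ +-mono-≤ at (sumOver-mono xs λ y∈xs → off _ (All.lookup x∉xs y∈xs ∘ sym)) ⟩
    (f x + δ) + sumOver f xs ≡⟨ xy∙z≈xz∙y (f x) δ (sumOver f xs) ⟩
    (f x + sumOver f xs) + δ ∎
    where open ≤-Reasoning
  ... | no x≢b = begin
    f' x + sumOver f' xs     ≤⟨ +-mono-≤ (off x x≢b) (sumOver-pointUpdate b uniq 0≤δ off at) ⟩
    f x + (sumOver f xs + δ) ≡⟨ sym (+-assoc (f x) (sumOver f xs) δ) ⟩
    (f x + sumOver f xs) + δ ∎
    where open ≤-Reasoning

sum-nonNeg : ∀ {n} {g : Fin n → ℚ} → (∀ i → 0ℚ ≤ℚ g i) → 0ℚ ≤ℚ sum g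
sum-nonNeg {ℕ.zero}  0≤g = ≤-refl
sum-nonNeg {ℕ.suc n} 0≤g = +-mono-≤ (0≤g zero) (sum-nonNeg (0≤g ∘ suc))

sum≡at+sum-updateAt-0 : ∀ {n} (g : Fin n → ℚ) a → sum g ≡ g a + sum (updateAt g a (const 0ℚ))
sum≡at+sum-updateAt-0 {ℕ.suc n} g zero    =
  cong (_+_ (g zero)) (sym (+-identityˡ (sum (g ∘ suc))))
sum≡at+sum-updateAt-0 {ℕ.suc n} g (suc a) = begin
  g zero + sum (g ∘ suc)         ≡⟨ cong (_+_ (g zero)) (sum≡at+sum-updateAt-0 (g ∘ suc) a) ⟩
  g zero + (g (suc a) + rest)    ≡⟨ x∙yz≈y∙xz (g zero) (g (suc a)) rest ⟩
  g (suc a) + (g zero + rest)    ∎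
  where
  open ≡-Reasoning
  rest = sum (updateAt (g ∘ suc) a (const 0ℚ))

sumOver≤sum : ∀ {n} {f g : Fin n → ℚ} {xs} → Unique xs → (∀ {x} → x ∈ᴸ xs → f x ≤ℚ g x) →
              (∀ i → 0ℚ ≤ℚ g i) → sumOver f xs ≤ℚ sum g
sumOver≤sum {xs = []}     _              _   0≤g = sum-nonNeg 0≤g
sumOver≤sum {f = f} {g} {a ∷ xs} (a∉xs ∷ uniq) f≤g 0≤g = begin
  f a + sumOver f xs ≤⟨ +-mono-≤ (f≤g (here refl)) (sumOver≤sum uniq f≤g₀ 0≤g₀) ⟩
  g a + sum g₀       ≡⟨ sum≡at+sum-updateAt-0 g a ⟨
  sum g              ∎
  where
  open ≤-Reasoning
  g₀ = updateAt g a (const 0ℚ)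
  f≤g₀ : ∀ {x} → x ∈ᴸ xs → f x ≤ℚ g₀ x
  f≤g₀ {x} x∈xs =
    subst (f x ≤ℚ_) (sym (updateAt-minimal x a g (All.lookup a∉xs x∈xs ∘ sym))) (f≤g (there x∈xs))
  0≤g₀ : ∀ i → 0ℚ ≤ℚ g₀ i
  0≤g₀ i with i ≟ a
  ... | yes refl = ≤-reflexive (sym (updateAt-updates a g))
  ... | no  i≢a  = subst (0ℚ ≤ℚ_) (sym (updateAt-minimal i a g i≢a)) (0≤g i)

sumOver≤weight : ∀ {n} {c : Fin n → ℚ} {X xs} → (∀ v → 0ℚ ≤ℚ c v) → Unique xs →
                 (∀ {x} → x ∈ᴸ xs → x ∈ X) → sumOver c xs ≤ℚ weight c X
sumOver≤weight {c = c} {X} 0≤c uniq xs⊆X = sumOver≤sum uniq c≤indicator 0≤indicator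
  where
  c≤indicator : ∀ {x} → x ∈ᴸ _ → c x ≤ℚ (if lookup X x then c x else 0ℚ)
  c≤indicator x∈xs rewrite []=⇒lookup (xs⊆X x∈xs) = ≤-refl
  0≤indicator : ∀ i → 0ℚ ≤ℚ (if lookup X i then c i else 0ℚ)
  0≤indicator i with lookup X i
  ... | true  = 0≤c i
  ... | false = ≤-refl

weight-nonNeg : ∀ {n} {c : Fin n → ℚ} X → (∀ v → 0ℚ ≤ℚ c v) → 0ℚ ≤ℚ weight c X
weight-nonNeg X 0≤c = sumOver≤weight {X = X} {xs = []} 0≤c [] (λ ())

∣p∪q∣≤∣p∣+∣q∣ : ∀ {n} (p q : Subset n) → ∣ p ∪ q ∣ ≤ ∣ p ∣ ℕ.+ ∣ q ∣
∣p∪q∣≤∣p∣+∣q∣ []          []          = ℕ.z≤n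
∣p∪q∣≤∣p∣+∣q∣ (true ∷ p)  (true ∷ q)  =
  ℕ.s≤s (ℕ.≤-trans (∣p∪q∣≤∣p∣+∣q∣ p q) (ℕ.+-monoʳ-≤ ∣ p ∣ (ℕ.n≤1+n ∣ q ∣)))
∣p∪q∣≤∣p∣+∣q∣ (true ∷ p)  (false ∷ q) = ℕ.s≤s (∣p∪q∣≤∣p∣+∣q∣ p q)
∣p∪q∣≤∣p∣+∣q∣ (false ∷ p) (true ∷ q)  =
  subst (ℕ.suc ∣ p ∪ q ∣ ≤_) (sym (ℕ.+-suc ∣ p ∣ ∣ q ∣)) (ℕ.s≤s (∣p∪q∣≤∣p∣+∣q∣ p q))
∣p∪q∣≤∣p∣+∣q∣ (false ∷ p) (false ∷ q) = ∣p∪q∣≤∣p∣+∣q∣ p q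

∪-monoˡ-⊆ : ∀ {n} {p q : Subset n} s → p ⊆ q → p ∪ s ⊆ q ∪ s
∪-monoˡ-⊆ {p = p} s p⊆q = Subset.x∈p∪q⁺ ∘ Sum.map₁ p⊆q ∘ Subset.x∈p∪q⁻ p s

∣⁅x⁆∪p∣*q≤q+∣p∣*q : ∀ {n} x (p : Subset n) {q} → 0ℚ ≤ℚ q →
                     (+ ∣ ⁅ x ⁆ ∪ p ∣ / 1) * q ≤ℚ q + (+ ∣ p ∣ / 1) * q
∣⁅x⁆∪p∣*q≤q+∣p∣*q x p {q} 0≤q = begin
  (+ ∣ ⁅ x ⁆ ∪ p ∣ / 1) * q    ≤⟨ *-monoʳ-≤-nonNeg q {{nonNegative 0≤q}} (/1-mono-≤ ∣⁅x⁆∪p∣≤1+∣p∣) ⟩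
  (+ ℕ.suc ∣ p ∣ / 1) * q      ≡⟨ cong (_* q) (+suc/1 ∣ p ∣) ⟩
  (1ℚ + + ∣ p ∣ / 1) * q       ≡⟨ *-distribʳ-+ q 1ℚ (+ ∣ p ∣ / 1) ⟩
  1ℚ * q + (+ ∣ p ∣ / 1) * q   ≡⟨ cong (_+ (+ ∣ p ∣ / 1) * q) (*-identityˡ q) ⟩
  q + (+ ∣ p ∣ / 1) * q        ∎
  where
  open ≤-Reasoning
  ∣⁅x⁆∪p∣≤1+∣p∣ : ∣ ⁅ x ⁆ ∪ p ∣ ≤ ℕ.suc ∣ p ∣
  ∣⁅x⁆∪p∣≤1+∣p∣ = subst (λ k → ∣ ⁅ x ⁆ ∪ p ∣ ≤ k ℕ.+ ∣ p ∣) (Subset.∣⁅x⁆∣≡1 x) (∣p∪q∣≤∣p∣+∣q∣ ⁅ x ⁆ p)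

count-bound : ∀ m {ε C} → (+ m / 1) * (ε * C) ≤ℚ C → m ≡ 0 ⊎ 0ℚ < C → (+ m / 1) * ε ≤ℚ 1ℚ
count-bound _ {ε} _ (inj₁ refl) = ≤-trans (≤-reflexive (*-zeroˡ ε)) (*≤* (ℤ.+≤+ ℕ.z≤n))
count-bound m {ε} {C} mεC≤C (inj₂ 0<C) = *-cancelʳ-≤-pos C {{positive 0<C}} (begin
  ((+ m / 1) * ε) * C ≡⟨ *-assoc (+ m / 1) ε C ⟩
  (+ m / 1) * (ε * C) ≤⟨ mεC≤C ⟩
  C                   ≡⟨ *-identityˡ C ⟨
  1ℚ * C              ∎)
  where open ≤-Reasoning

module LoopErasure {n} {A : Rel' n} (c : Fin n → ℚ) (0≤c : ∀ v → 0ℚ ≤ℚ c v) where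

  open import Data.List.Membership.DecPropositional (_≟_ {n}) using () renaming (_∈?_ to _∈ᴸ?_)

  PathWithin : ℚ → Fin n → Fin n → Set
  PathWithin bound u v = Σ (Walk A u v) λ P → IsPath P × (costExceptEnd c P ≤ℚ bound)

  PathWithin-mono : ∀ {b b' u v} → b ≤ℚ b' → PathWithin b u v → PathWithin b' u v
  PathWithin-mono b≤b' (P , isPath , cost≤b) = P , isPath , ≤-trans cost≤b b≤b'

  pathSuffix : ∀ {u v x} (P : Walk A u v) → IsPath P → x ∈ᴸ vertices P →
               PathWithin (costExceptEnd c P) x v
  pathSuffix here         isPath       (here refl) = here , isPath , ≤-refl
  pathSuffix (step e P)   isPath       (here refl) = step e P , isPath , ≤-refl
  pathSuffix (step {u} _ P) (_ ∷ isPath) (there x∈P) =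
    PathWithin-mono (p≤q+p _ (0≤c u)) (pathSuffix P isPath x∈P)

  loopErase : ∀ {u v} (P : Walk A u v) → PathWithin (costExceptEnd c P) u v
  loopErase here = here , [] ∷ [] , ≤-refl
  loopErase (step {u} e P) with loopErase P
  ... | Q , isPath , Q≤P with u ∈ᴸ? vertices Q
  ...   | yes u∈Q = PathWithin-mono (≤-trans Q≤P (p≤q+p _ (0≤c u))) (pathSuffix Q isPath u∈Q)
  ...   | no  u∉Q = step e Q , ¬Any⇒All¬ (vertices Q) u∉Q ∷ isPath , +-monoʳ-≤ (c u) Q≤P

module _ {n} (A : Rel' n) (r : Fin n) where

  -- A tree rooted at r on the vertices r ∷ xs, listed so that every vertex a
  -- comes before its parent b.
  data Growth : List (Fin n) → Set where
    seed   : Growth []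
    sprout : ∀ {xs} a b → a ∉ r ∷ xs → b ∈ᴸ r ∷ xs → A a b → Growth xs → Growth (a ∷ xs)

  Growth⇒Unique : ∀ {xs} → Growth xs → Unique xs
  Growth⇒Unique seed                       = []
  Growth⇒Unique (sprout {xs} a _ a∉ _ _ g) = ¬Any⇒All¬ xs (a∉ ∘ there) ∷ Growth⇒Unique g

module Spanning {n} {A : Rel' n} {r : Fin n} {VT : Subset n} {ET : Rel' n}
                (subgraph  : IsSubgraph A VT ET)
                (connected : ∀ {u v} → u ∈ VT → v ∈ VT → Walk ET u v)
                (r∈VT      : r ∈ VT) where

  open IsSubgraph subgraph
  open import Data.List.Membership.DecPropositional (_≟_ {n}) using () renaming (_∈?_ to _∈ᴸ?_)

  record Grown (S : List (Fin n)) : Set where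
    field
      order    : List (Fin n)
      growth   : Growth A r order
      order⊆VT : ∀ {x} → x ∈ᴸ order → x ∈ VT
      reaches  : ∀ {x} → x ∈ᴸ S → x ∈ᴸ r ∷ order
  open Grown

  shrink : ∀ {y S} → Grown (y ∷ S) → Grown S
  shrink G = record
    { order    = order G
    ; growth   = growth G
    ; order⊆VT = order⊆VT G
    ; reaches  = reaches G ∘ there
    }

  alreadyGrown : ∀ {x S} (G : Grown S) → x ∈ᴸ r ∷ order G → Grown (x ∷ S)
  alreadyGrown G x∈ = record
    { order    = order G
    ; growth   = growth G
    ; order⊆VT = order⊆VT G
    ; reaches  = λ { (here refl) → x∈ ; (there z∈S) → reaches G z∈S }
    }

  growAlong : ∀ {x S} → Walk ET x r → Grown S → Grown (x ∷ S)
  growAlong here G = alreadyGrown G (here refl)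
  growAlong {x} (step {w = y} e P) G with growAlong P G
  ... | G' with x ∈ᴸ? r ∷ order G'
  ...   | yes x∈ = alreadyGrown (shrink G') x∈
  ...   | no  x∉ = record
    { order    = x ∷ order G'
    ; growth   = sprout x y x∉ (reaches G' (here refl)) (edge-sub e) (growth G')
    ; order⊆VT = λ { (here refl) → edge-inˡ e ; (there z∈) → order⊆VT G' z∈ }
    ; reaches  = λ { (here refl) → there (here refl) ; (there z∈S) → insert (reaches G' (there z∈S)) }
    }
    where
    insert : ∀ {z} → z ∈ᴸ r ∷ order G' → z ∈ᴸ r ∷ x ∷ order G'
    insert (here refl) = here refl
    insert (there z∈)  = there (there z∈)

  grown : ∀ S → (∀ {x} → x ∈ᴸ S → x ∈ VT) → Grown S
  grown []      _    = record { order = [] ; growth = seed ; order⊆VT = λ () ; reaches = λ () }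
  grown (x ∷ S) S⊆VT = growAlong (connected (S⊆VT (here refl)) r∈VT) (grown S (S⊆VT ∘ there))

  spanning : Grown (filter (_∈? VT) (allFin n))
  spanning = grown _ (λ x∈ → proj₂ (∈-filter⁻ (_∈? VT) {xs = allFin n} x∈))

  spanning-reaches : ∀ {x} → x ∈ VT → x ∈ᴸ r ∷ order spanning
  spanning-reaches {x} x∈VT = reaches spanning (∈-filter⁺ (_∈? VT) (∈-allFin x) x∈VT)

module Covering {n} {A : Rel' n} {r : Fin n} (c : Fin n → ℚ) (0≤c : ∀ v → 0ℚ ≤ℚ c v)
                (B : ℚ) (0≤B : 0ℚ ≤ℚ B) where

  load : (Fin n → ℚ) → List (Fin n) → ℚ
  load h = sumOver (λ x → h x + c x)

  load-nonNeg : ∀ {h} → (∀ y → 0ℚ ≤ℚ h y) → ∀ xs → 0ℚ ≤ℚ load h xs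
  load-nonNeg 0≤h = sumOver-nonNeg (λ y → +-mono-≤ (0≤h y) (0≤c y))

  record Reach (T : Subset n) (h : Fin n → ℚ) (a : Fin n) : Set where
    constructor mkReach
    field
      {target} : Fin n
      target∈  : target ∈ T
      walk     : Walk A a target
      bound    : h a + costExceptEnd c walk ≤ℚ B

  Reach-here : ∀ {T h a} → a ∈ T → h a ≤ℚ B → Reach T h a
  Reach-here {h = h} {a} a∈T ha≤B = mkReach a∈T here (≤-trans (≤-reflexive (+-identityʳ (h a))) ha≤B)

  Reach-mono : ∀ {T T' h h' a} → T ⊆ T' → h a ≤ℚ h' a → Reach T h' a → Reach T' h a
  Reach-mono T⊆T' ha≤h'a (mkReach z∈T P bound) =
    mkReach (T⊆T' z∈T) P (≤-trans (+-monoˡ-≤ (costExceptEnd c P) ha≤h'a) bound)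

  -- h a bounds the cost of the walks from the already swept vertices below a
  -- up to a, excluding a itself.
  record Cover (xs : List (Fin n)) (h : Fin n → ℚ) : Set where
    field
      centres          : Subset n
      centres⊆         : ∀ {x} → x ∈ centres → x ∈ᴸ xs
      paid             : (+ ∣ centres ∣ / 1) * B ≤ℚ load h xs
      none-or-positive : ∣ centres ∣ ≡ 0 ⊎ 0ℚ < load h xs
      reach            : ∀ {a} → a ∈ᴸ r ∷ xs → Reach (centres ∪ ⁅ r ⁆) h a
  open Cover

  raise : (Fin n → ℚ) → Fin n → ℚ → Fin n → ℚ
  raise h b x = updateAt h b (_⊔ x)

  raise-cases : ∀ h b x y → raise h b x y ≡ h y ⊎ raise h b x y ≡ h y ⊔ x
  raise-cases h b x y with y ≟ b
  ... | yes refl = inj₂ (updateAt-updates b h)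
  ... | no  y≢b  = inj₁ (updateAt-minimal y b h y≢b)

  ≤-raise : ∀ h b x y → h y ≤ℚ raise h b x y
  ≤-raise h b x y with raise-cases h b x y
  ... | inj₁ eq = ≤-reflexive (sym eq)
  ... | inj₂ eq = subst (h y ≤ℚ_) (sym eq) (p≤p⊔q (h y) x)

  raise-≤ : ∀ {h b x} → (∀ y → h y ≤ℚ B) → x ≤ℚ B → ∀ y → raise h b x y ≤ℚ B
  raise-≤ {h} {b} {x} h≤B x≤B y with raise-cases h b x y
  ... | inj₁ eq = subst (_≤ℚ B) (sym eq) (h≤B y)
  ... | inj₂ eq = subst (_≤ℚ B) (sym eq) (⊔-lub (h≤B y) x≤B)

  load-raise : ∀ {h b x xs} → Unique xs → 0ℚ ≤ℚ h b → 0ℚ ≤ℚ x →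
               load (raise h b x) xs ≤ℚ load h xs + x
  load-raise {h} {b} {x} uniq 0≤hb 0≤x = sumOver-pointUpdate b uniq 0≤x off at
    where
    off : ∀ y → y ≢ b → raise h b x y + c y ≤ℚ h y + c y
    off y y≢b = ≤-reflexive (cong (_+ c y) (updateAt-minimal y b h y≢b))
    at : raise h b x b + c b ≤ℚ (h b + c b) + x
    at = begin
      raise h b x b + c b ≡⟨ cong (_+ c b) (updateAt-updates b h) ⟩
      (h b ⊔ x) + c b     ≤⟨ +-monoˡ-≤ (c b) (p⊔q≤p+q 0≤hb 0≤x) ⟩
      (h b + x) + c b     ≡⟨ xy∙z≈xz∙y (h b) x (c b) ⟩
      (h b + c b) + x     ∎
      where open ≤-Reasoning

  emptyCover : ∀ h → (∀ y → h y ≤ℚ B) → Cover [] h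
  emptyCover h h≤B = record
    { centres          = ⊥
    ; centres⊆         = ⊥-elim ∘ Subset.∉⊥
    ; paid             = ≤-reflexive (trans (cong (λ m → (+ m / 1) * B) (Subset.∣⊥∣≡0 n)) (*-zeroˡ B))
    ; none-or-positive = inj₁ (Subset.∣⊥∣≡0 n)
    ; reach            = λ { (here refl) → Reach-here (Subset.x∈p∪q⁺ (inj₂ (Subset.x∈⁅x⁆ r))) (h≤B r)
                           ; (there ()) }
    }

  addCentre : ∀ {xs h} a → (∀ y → 0ℚ ≤ℚ h y) → h a ≤ℚ B → B < h a + c a →
              Cover xs h → Cover (a ∷ xs) h
  addCentre {xs} {h} a 0≤h ha≤B B<ha+ca C = record
    { centres          = ⁅ a ⁆ ∪ centres C
    ; centres⊆         = Sum.[ here ∘ Subset.x∈⁅y⁆⇒x≡y a , there ∘ centres⊆ C ] ∘ Subset.x∈p∪q⁻ _ _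
    ; paid             = ≤-trans (∣⁅x⁆∪p∣*q≤q+∣p∣*q a (centres C) 0≤B) (+-mono-≤ (<⇒≤ B<ha+ca) (paid C))
    ; none-or-positive = inj₂ (≤-<-trans 0≤B (<-≤-trans B<ha+ca (p≤p+q _ (load-nonNeg 0≤h xs))))
    ; reach            = λ { (here refl)          → Reach-mono ⊆new ≤-refl (reach C (here refl))
                           ; (there (here refl))  → Reach-here a∈new ha≤B
                           ; (there (there y∈xs)) → Reach-mono ⊆new ≤-refl (reach C (there y∈xs)) }
    }
    where
    ⊆new : centres C ∪ ⁅ r ⁆ ⊆ (⁅ a ⁆ ∪ centres C) ∪ ⁅ r ⁆
    ⊆new = ∪-monoˡ-⊆ ⁅ r ⁆ (Subset.q⊆p∪q ⁅ a ⁆ (centres C))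
    a∈new : a ∈ (⁅ a ⁆ ∪ centres C) ∪ ⁅ r ⁆
    a∈new = Subset.x∈p∪q⁺ (inj₁ (Subset.x∈p∪q⁺ (inj₁ (Subset.x∈⁅x⁆ a))))

  passUp : ∀ {xs h} a b → b ∈ᴸ r ∷ xs → A a b → Unique xs → (∀ y → 0ℚ ≤ℚ h y) →
           Cover xs (raise h b (h a + c a)) → Cover (a ∷ xs) h
  passUp {xs} {h} a b b∈ ab uniq 0≤h C = record
    { centres          = centres C
    ; centres⊆         = there ∘ centres⊆ C
    ; paid             = ≤-trans (paid C) load≤
    ; none-or-positive = Sum.map₂ (λ 0<load → <-≤-trans 0<load load≤) (none-or-positive C)
    ; reach            = λ { (here refl)          → lower (reach C (here refl))
                           ; (there (here refl))  → reach-a (reach C b∈)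
                           ; (there (there y∈xs)) → lower (reach C (there y∈xs)) }
    }
    where
    x = h a + c a
    0≤x : 0ℚ ≤ℚ x
    0≤x = +-mono-≤ (0≤h a) (0≤c a)
    load≤ : load (raise h b x) xs ≤ℚ load h (a ∷ xs)
    load≤ = ≤-trans (load-raise uniq (0≤h b) 0≤x) (≤-reflexive (+-comm (load h xs) x))
    lower : ∀ {y} → Reach (centres C ∪ ⁅ r ⁆) (raise h b x) y → Reach (centres C ∪ ⁅ r ⁆) h y
    lower = Reach-mono Subset.⊆-refl (≤-raise h b x _)
    x≤raise-b : x ≤ℚ raise h b x b
    x≤raise-b = subst (x ≤ℚ_) (sym (updateAt-updates b {_⊔ x} h)) (p≤q⊔p (h b) x)
    reach-a : Reach (centres C ∪ ⁅ r ⁆) (raise h b x) b → Reach (centres C ∪ ⁅ r ⁆) h a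
    reach-a (mkReach z∈ P bound) = mkReach z∈ (step ab P) (begin
      h a + (c a + costExceptEnd c P)   ≡⟨ +-assoc (h a) (c a) _ ⟨
      x + costExceptEnd c P             ≤⟨ +-monoˡ-≤ _ x≤raise-b ⟩
      raise h b x b + costExceptEnd c P ≤⟨ bound ⟩
      B                                 ∎)
      where open ≤-Reasoning

  covering : ∀ {xs} → Growth A r xs → (h : Fin n → ℚ) → (∀ y → 0ℚ ≤ℚ h y) → (∀ y → h y ≤ℚ B) →
             Cover xs h
  covering seed h _ h≤B = emptyCover h h≤B
  covering (sprout a b _ b∈ ab g) h 0≤h h≤B with B <? h a + c a
  ... | yes B<x = addCentre a 0≤h (h≤B a) B<x (covering g h 0≤h h≤B)
  ... | no  B≮x = passUp a b b∈ ab (Growth⇒Unique A r g) 0≤h (covering g (raise h b x) 0≤h' h'≤B)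
    where
    x = h a + c a
    0≤h' : ∀ y → 0ℚ ≤ℚ raise h b x y
    0≤h' y = ≤-trans (0≤h y) (≤-raise h b x y)
    h'≤B : ∀ y → raise h b x y ≤ℚ B
    h'≤B = raise-≤ h≤B (≮⇒≥ B≮x)

lemma1 : (n : ℕ) (Adj : Rel' n) → IsSimpleGraph Adj →
         (c : Fin n → ℚ) → (∀ v → 0ℚ ≤ℚ c v) →
         (r : Fin n) (k : ℕ) → 1 ≤ k →
         (VT : Subset n) (ET : Rel' n) → Optimal Adj c r k VT ET →
         (ε : ℚ) → 0ℚ < ε →
         Σ (Subset n) λ W → W ⊆ VT × ((+ ∣ W ∣ / 1) * ε ≤ℚ 1ℚ) ×
           (∀ v → v ∈ VT → Distant Adj c (ε * weight c VT) (W ∪ ⁅ r ⁆) v)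
lemma1 n Adj _ c 0≤c r k _ VT ET opt ε 0<ε = centres , order⊆VT ∘ centres⊆ , count , distant
  where
  open Feasible (Optimal.feasible opt)
  open IsTree tree
  open Spanning subgraph connected root
  open Grown spanning
  0≤εC : 0ℚ ≤ℚ ε * weight c VT
  0≤εC = nonNegative⁻¹ _ {{nonNeg*nonNeg⇒nonNeg ε {{nonNegative (<⇒≤ 0<ε)}}
                                               (weight c VT) {{nonNegative (weight-nonNeg VT 0≤c)}}}}
  open Covering {A = Adj} {r} c 0≤c (ε * weight c VT) 0≤εC
  open Cover (covering growth (const 0ℚ) (λ _ → ≤-refl) (λ _ → 0≤εC))
  open LoopErasure c 0≤c
  load≤weight : load (const 0ℚ) order ≤ℚ weight c VT
  load≤weight = ≤-trans (sumOver-mono order (λ _ → ≤-reflexive (+-identityˡ _)))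
                        (sumOver≤weight 0≤c (Growth⇒Unique Adj r growth) order⊆VT)
  count : (+ ∣ centres ∣ / 1) * ε ≤ℚ 1ℚ
  count = count-bound ∣ centres ∣ (≤-trans paid load≤weight)
                      (Sum.map₂ (λ 0<load → <-≤-trans 0<load load≤weight) none-or-positive)
  distant : ∀ v → v ∈ VT → Distant Adj c (ε * weight c VT) (centres ∪ ⁅ r ⁆) v
  distant v v∈VT with reach (spanning-reaches v∈VT)
  ... | mkReach z∈ P bound =
    _ , z∈ , PathWithin-mono (≤-trans (≤-reflexive (sym (+-identityˡ _))) bound) (loopErase P)
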